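{- Let $R$ be a ring and $N$ a nilpotent ideal of $R$ of nilpotency index $k\ge 2$. Let $s>1$ be the characteristic of the quotient ring $R/N$. Then: (1) If $w$ is a natural number with $\bar x^{\,w}=\bar 1$ for all $\bar x\in (R/N)^*$, then $x^{w s^{k-1}}=1$ for all $x\in R^*$. (2) If $(R/N)^*$ is finite, then $x^{|(R/N)^*|\, s^{k-1}}=1$ for all $x\in R^*$. (3) If $R^*$ is finite, then $x^{|(R/N)^*|\,|N|}=1$ for all $x\in R^*$.
   Context: Rings are associative with identity, not necessarily commutative; $S^*$ denotes the group of units of a ring $S$. The characteristic of a ring $S$ is the least positive integer $s$ with $s\cdot 1_S=0$. The nilpotency index of $N$ is the least $k$ with $N^k=\{0\}$. -}

module Defs where

open import Level using (Level; _⊔_)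
open import Data.Nat using (ℕ; zero; suc; _<_; _≤_; _*_; _^_; _∸_)
open import Data.Fin using (Fin)
open import Data.Product using (Σ; _×_)
open import Relation.Binary.PropositionalEquality using (_≡_)
open import Relation.Nullary using (¬_)
open import Algebra.Bundles using (Ring)

module RingDefs {c ℓ : Level} (R : Ring c ℓ) where
  open Ring R renaming (_*_ to _·_; _+_ to _⊕_)

  pow : Carrier → ℕ → Carrier
  pow x zero    = 1#
  pow x (suc n) = x · pow x n

  nat· : ℕ → Carrier
  nat· zero    = 0#
  nat· (suc n) = 1# ⊕ nat· n

  prodF : (n : ℕ) → (Fin n → Carrier) → Carrier
  prodF zero    f = 1#
  prodF (suc n) f = f Fin.zero · prodF n (λ i → f (Fin.suc i))

  record IsIdeal {ℓN : Level} (N : Carrier → Set ℓN) : Set (c ⊔ ℓ ⊔ ℓN) where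
    field
      resp    : ∀ {x y} → x ≈ y → N x → N y
      zero∈   : N 0#
      +-closed : ∀ {x y} → N x → N y → N (x ⊕ y)
      neg-closed : ∀ {x} → N x → N (- x)
      absorbˡ : ∀ r {x} → N x → N (r · x)
      absorbʳ : ∀ r {x} → N x → N (x · r)

  -- N^m = {0}: since N^m is the additive subgroup generated by the products
  -- of m elements of N, this says every such product is 0.
  PowZero : {ℓN : Level} → (Carrier → Set ℓN) → ℕ → Set (c ⊔ ℓ ⊔ ℓN)
  PowZero N m = (f : Fin m → Carrier) → (∀ i → N (f i)) → prodF m f ≈ 0#

  NilpotencyIndex : {ℓN : Level} → (Carrier → Set ℓN) → ℕ → Set (c ⊔ ℓ ⊔ ℓN)
  NilpotencyIndex N k = PowZero N k × (∀ j → j < k → ¬ PowZero N j)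

  _≡[_]_ : {ℓN : Level} → Carrier → (Carrier → Set ℓN) → Carrier → Set ℓN
  x ≡[ N ] y = N (x - y)

  IsUnit : Carrier → Set (c ⊔ ℓ)
  IsUnit x = Σ Carrier λ y → (x · y ≈ 1#) × (y · x ≈ 1#)

  IsUnitMod : {ℓN : Level} → (Carrier → Set ℓN) → Carrier → Set (c ⊔ ℓN)
  IsUnitMod N x = Σ Carrier λ y → ((x · y) ≡[ N ] 1#) × ((y · x) ≡[ N ] 1#)

  CharMod : {ℓN : Level} → (Carrier → Set ℓN) → ℕ → Set ℓN
  CharMod N s = (1 ≤ s) × N (nat· s) × (∀ t → 1 ≤ t → t < s → ¬ N (nat· t))

  HasCard : {ℓP ℓE : Level} → (P : Carrier → Set ℓP) → (E : Carrier → Carrier → Set ℓE)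
          → ℕ → Set (c ⊔ ℓP ⊔ ℓE)
  HasCard P E m = Σ (Fin m → Carrier) λ e →
      (∀ i → P (e i))
    × (∀ i j → E (e i) (e j) → i ≡ j)
    × (∀ x → P x → Σ (Fin m) λ i → E x (e i))

{-# OPTIONS --safe #-}
module Submission where

-- Let y ≡ 1 mod N. Then 1 − yˢ = (1 − y)(1 + y + ⋯ + yˢ⁻¹), and the second factor is
-- ≡ s·1 ≡ 0 mod N; so if (1 − y)Nʳ⁺¹ = 0 then (1 − yˢ)Nʳ = 0. Since (1 − y)Nᵏ⁻¹ = 0,
-- k − 1 such steps give y^(sᵏ⁻¹) = 1. This proves (1) with y = xʷ, and (2) follows because
-- Lagrange's theorem in (R/N)* gives x^|(R/N)*| ≡ 1 mod N. For (3), 1 + N is a group of units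
-- of order |N| (the inverse of 1 − x is a geometric series in the nilpotent x), and Lagrange's
-- theorem in it applies to x^|(R/N)*|. Lagrange's theorem itself: right multiplication by g
-- permutes a finite group freely, so all orbits have the size d of the first return, d divides
-- the order n, and gⁿ = 1.

open import Defs
open import Level using (Level; _⊔_)
open import Data.Nat.Base using (ℕ)
open import Data.Product using (_×_)
open import Algebra.Bundles using (Ring; Monoid)

module PermutationPowers where
  open import Data.Nat.Base
    using (ℕ; zero; suc; _+_; _*_; _∸_; _≤_; _<_; NonZero; >-nonZero)
  open import Data.Nat.Properties
    using ( _≟_; _≤?_; _<?_; anyUpTo?; ≮⇒≥; <⇒≤; <-cmp; ≤-antisym; ≤-<-trans; n<1+n
          ; m∸n≤m; m<n⇒0<n∸m; m+[n∸m]≡n; *-identityʳ; *-comm; +-0-commutativeMonoid)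
  open import Data.Nat.DivMod using (_%_; _/_; _mod_; m%n<n; m≡m%n+[m/n]*n)
  open import Data.Nat.Divisibility using (_∣_; divides)
  open import Data.Nat.GeneralisedArithmetic using (iterate)
  open import Data.Nat.Induction using (<-rec)
  open import Data.Fin.Base using (Fin; zero; suc; toℕ)
  open import Data.Fin.Properties
    using (toℕ-injective; toℕ<n; toℕ-fromℕ<; pigeonhole; all?; any?; 0≢1+n; suc-injective)
    renaming (_≟_ to _≟ᶠ_)
  open import Data.Fin.Permutation using (Permutation′; _⟨$⟩ʳ_)
  open import Data.Product using (∃; ∃-syntax; _×_; _,_; proj₁; proj₂)
  open import Data.Empty using (⊥-elim)
  open import Function using (_∘_)
  open import Relation.Binary.Definitions using (tri<; tri≈; tri>)
  open import Relation.Binary.PropositionalEquality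
  open import Relation.Nullary using (¬_; Dec; yes; no; _×-dec_)
  open import Relation.Unary using (Pred; Decidable)
  open import Algebra.Properties.CommutativeMonoid.Sum +-0-commutativeMonoid
    using (sum; sum-permute; ∑-comm; sum-cong-≗)

  least-witness : ∀ {q} {Q : Pred ℕ q} → Decidable Q →
                  ∀ {m} → Q m → ∃[ d ] Q d × (∀ {j} → j < d → ¬ Q j)
  least-witness {Q = Q} Q? {m} = <-rec Least search m
    where
    Least : ℕ → Set _
    Least m = Q m → ∃[ d ] Q d × (∀ {j} → j < d → ¬ Q j)

    search : ∀ m → (∀ {j} → j < m → Least j) → Least m
    search m smaller qm with anyUpTo? Q? m
    ... | yes (j , j<m , qj) = smaller j<m qj
    ... | no none           = m , qm , λ j<m qj → none (_ , j<m , qj)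

  argmin : ∀ {d} (f : Fin d → ℕ) → Fin d → ∃[ t ] ∀ x → f t ≤ f x
  argmin f x₀ with least-witness (λ v → any? (λ x → f x ≟ v)) (x₀ , refl)
  ... | _ , (t , refl) , minimal = t , λ x → ≮⇒≥ λ fx<ft → minimal fx<ft (x , refl)

  indicator : ∀ {a} {A : Set a} → Dec A → ℕ
  indicator (yes _) = 1
  indicator (no _)  = 0

  sum-const : ∀ m c → sum {m} (λ _ → c) ≡ m * c
  sum-const zero    c = refl
  sum-const (suc m) c = cong (c +_) (sum-const m c)

  sum-indicator-empty : ∀ {d p} {P : Pred (Fin d) p} (P? : Decidable P) →
                        (∀ x → ¬ P x) → sum (indicator ∘ P?) ≡ 0
  sum-indicator-empty {zero}  P? none = refl
  sum-indicator-empty {suc d} P? none with P? zero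
  ... | yes p = ⊥-elim (none _ p)
  ... | no _  = sum-indicator-empty (P? ∘ suc) (none ∘ suc)

  sum-indicator-unique : ∀ {d p} {P : Pred (Fin d) p} (P? : Decidable P) {t} →
                         P t → (∀ {x} → P x → x ≡ t) → sum (indicator ∘ P?) ≡ 1
  sum-indicator-unique {suc d} P? {zero} pt unique with P? zero
  ... | yes _ = cong suc (sum-indicator-empty (P? ∘ suc) (λ x p → 0≢1+n (sym (unique p))))
  ... | no ¬p = ⊥-elim (¬p pt)
  sum-indicator-unique {suc d} P? {suc t} pt unique with P? zero
  ... | yes p = ⊥-elim (0≢1+n (unique p))
  ... | no _  = sum-indicator-unique (P? ∘ suc) pt (suc-injective ∘ unique)

  infixl 9 _^[_]_

  _^[_]_ : ∀ {n} → Permutation′ n → ℕ → Fin n → Fin n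
  π ^[ j ] i = iterate (π ⟨$⟩ʳ_) i j

  module _ {n} (π : Permutation′ n) where

    ^[+] : ∀ a b {i} → π ^[ a + b ] i ≡ π ^[ b ] (π ^[ a ] i)
    ^[+] zero    b = refl
    ^[+] (suc a) b = ^[+] a b

    ^[∸] : ∀ {x y i} → x ≤ y → π ^[ y ∸ x ] (π ^[ x ] i) ≡ π ^[ y ] i
    ^[∸] {x} {y} {i} x≤y = trans (sym (^[+] x (y ∸ x))) (cong (λ b → π ^[ b ] i) (m+[n∸m]≡n x≤y))

    sum-∘^[] : ∀ j (f : Fin n → ℕ) → sum (λ i → f (π ^[ j ] i)) ≡ sum f
    sum-∘^[] zero    f = refl
    sum-∘^[] (suc j) f = trans (sym (sum-permute (λ i → f (π ^[ j ] i)) π)) (sum-∘^[] j f)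

    Semiregular : Set
    Semiregular = ∀ j {i i′} → π ^[ j ] i ≡ i → π ^[ j ] i′ ≡ i′


    module FreeOrbits (d : ℕ) .{{_ : NonZero d}}
                      (period : ∀ i → π ^[ d ] i ≡ i)
                      (aperiodic : ∀ {j i} → 0 < j → j < d → π ^[ j ] i ≢ i) where

      ^[*d] : ∀ q {i} → π ^[ q * d ] i ≡ i
      ^[*d] zero            = refl
      ^[*d] (suc q) {i} = trans (^[+] d (q * d)) (trans (cong (π ^[ q * d ]_) (period i)) (^[*d] q))

      ^[mod] : ∀ a {i} → π ^[ toℕ (a mod d) ] i ≡ π ^[ a ] i
      ^[mod] a {i} = begin
        π ^[ toℕ (a mod d) ] i            ≡⟨ cong (λ b → π ^[ b ] i) (toℕ-fromℕ< (m%n<n a d)) ⟩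
        π ^[ a % d ] i                    ≡⟨ ^[*d] (a / d) ⟨
        π ^[ (a / d) * d ] (π ^[ a % d ] i) ≡⟨ ^[+] (a % d) ((a / d) * d) ⟨
        π ^[ a % d + (a / d) * d ] i      ≡⟨ cong (λ b → π ^[ b ] i) (m≡m%n+[m/n]*n a d) ⟨
        π ^[ a ] i                        ∎
        where open ≡-Reasoning

      ^[]-return : ∀ {a} b {i} → a ≤ d → π ^[ (d ∸ a) + b ] (π ^[ a ] i) ≡ π ^[ b ] i
      ^[]-return {a} b {i} a≤d = begin
        π ^[ (d ∸ a) + b ] (π ^[ a ] i) ≡⟨ ^[+] (d ∸ a) b ⟩
        π ^[ b ] (π ^[ d ∸ a ] (π ^[ a ] i)) ≡⟨ cong (π ^[ b ]_) (^[∸] a≤d) ⟩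
        π ^[ b ] (π ^[ d ] i)                ≡⟨ cong (π ^[ b ]_) (period i) ⟩
        π ^[ b ] i                           ∎
        where open ≡-Reasoning

      ^[]-injective< : ∀ {x y i} → x < y → y < d → π ^[ x ] i ≢ π ^[ y ] i
      ^[]-injective< {x} {y} x<y y<d eq =
        aperiodic (m<n⇒0<n∸m x<y) (≤-<-trans (m∸n≤m y x) y<d) (trans (^[∸] (<⇒≤ x<y)) (sym eq))

      ^[]-injective : ∀ {x y i} → x < d → y < d → π ^[ x ] i ≡ π ^[ y ] i → x ≡ y
      ^[]-injective {x} {y} x<d y<d eq with <-cmp x y
      ... | tri< x<y _ _ = ⊥-elim (^[]-injective< x<y y<d eq)
      ... | tri≈ _ x≡y _ = x≡y
      ... | tri> _ _ y<x = ⊥-elim (^[]-injective< y<x x<d (sym eq))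

      IsOrbitMinimum : Fin n → Set
      IsOrbitMinimum y = ∀ (x : Fin d) → toℕ y ≤ toℕ (π ^[ toℕ x ] y)

      orbitMinimum? : Decidable IsOrbitMinimum
      orbitMinimum? y = all? (λ x → toℕ y ≤? toℕ (π ^[ toℕ x ] y))

      orbitMinimum-≤ : ∀ {y} → IsOrbitMinimum y → ∀ j → toℕ y ≤ toℕ (π ^[ j ] y)
      orbitMinimum-≤ {y} minimum j = subst (λ z → toℕ y ≤ toℕ z) (^[mod] j) (minimum (j mod d))

      orbitMinimum-unique : ∀ {a b i} → a ≤ d → b ≤ d →
        IsOrbitMinimum (π ^[ a ] i) → IsOrbitMinimum (π ^[ b ] i) → π ^[ a ] i ≡ π ^[ b ] i
      orbitMinimum-unique {a} {b} a≤d b≤d min-a min-b = toℕ-injective (≤-antisym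
        (subst (λ z → _ ≤ toℕ z) (^[]-return b a≤d) (orbitMinimum-≤ min-a ((d ∸ a) + b)))
        (subst (λ z → _ ≤ toℕ z) (^[]-return a b≤d) (orbitMinimum-≤ min-b ((d ∸ b) + a))))

      orbit-has-one-minimum : ∀ i → sum (λ (x : Fin d) → indicator (orbitMinimum? (π ^[ toℕ x ] i))) ≡ 1
      orbit-has-one-minimum i = sum-indicator-unique (λ x → orbitMinimum? (π ^[ toℕ x ] i)) t-minimum unique
        where
        position : Fin d → ℕ
        position x = toℕ (π ^[ toℕ x ] i)

        minimal-position : ∃[ t ] ∀ x → position t ≤ position x
        minimal-position = argmin position (0 mod d)

        t : Fin d
        t = proj₁ minimal-position

        t-minimum : IsOrbitMinimum (π ^[ toℕ t ] i)
        t-minimum x = subst (λ z → position t ≤ toℕ z)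
                            (trans (^[mod] (toℕ t + toℕ x)) (^[+] (toℕ t) (toℕ x)))
                            (proj₂ minimal-position ((toℕ t + toℕ x) mod d))

        unique : ∀ {x} → IsOrbitMinimum (π ^[ toℕ x ] i) → x ≡ t
        unique {x} min-x = toℕ-injective (^[]-injective (toℕ<n x) (toℕ<n t)
          (orbitMinimum-unique (<⇒≤ (toℕ<n x)) (<⇒≤ (toℕ<n t)) min-x t-minimum))

      -- Count the pairs (i, x) such that π^x i is the minimum of its orbit in two ways.
      orbitSize∣n : d ∣ n
      orbitSize∣n = divides minima (begin
        n                                       ≡⟨ *-identityʳ n ⟨
        n * 1                                   ≡⟨ sum-const n 1 ⟨
        sum {n} (λ _ → 1)                       ≡⟨ sum-cong-≗ (sym ∘ orbit-has-one-minimum) ⟩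
        sum (λ i → sum (λ x → minimumAt x i))   ≡⟨ ∑-comm (λ i x → minimumAt x i) ⟩
        sum (λ x → sum (λ i → minimumAt x i))   ≡⟨ sum-cong-≗ {d} (λ x → sum-∘^[] (toℕ x) _) ⟩
        sum {d} (λ _ → minima)                  ≡⟨ sum-const d minima ⟩
        d * minima                              ≡⟨ *-comm d minima ⟩
        minima * d                              ∎)
        where
        open ≡-Reasoning
        minimumAt : Fin d → Fin n → ℕ
        minimumAt x i = indicator (orbitMinimum? (π ^[ toℕ x ] i))
        minima : ℕ
        minima = sum (indicator ∘ orbitMinimum?)

      ^[n]≡id : ∀ i → π ^[ n ] i ≡ i
      ^[n]≡id i with orbitSize∣n
      ... | divides q n≡q*d = trans (cong (λ m → π ^[ m ] i) n≡q*d) (^[*d] q)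

    semiregular⇒^[n]≡id : Semiregular → ∀ i → π ^[ n ] i ≡ i
    semiregular⇒^[n]≡id semiregular i with least-witness returns? (proj₂ returns-somewhere)
      where
      Returns : ℕ → Set
      Returns j = 0 < j × π ^[ j ] i ≡ i

      returns? : Decidable Returns
      returns? j = (0 <? j) ×-dec (π ^[ j ] i ≟ᶠ i)

      returns-somewhere : ∃ Returns
      returns-somewhere with pigeonhole (n<1+n n) (λ k → π ^[ toℕ k ] i)
      ... | a , b , a<b , eq =
        _ , m<n⇒0<n∸m a<b , semiregular (toℕ b ∸ toℕ a) (trans (^[∸] (<⇒≤ a<b)) (sym eq))
    ... | d , (0<d , returns) , minimal =
      FreeOrbits.^[n]≡id d {{>-nonZero 0<d}} (λ _ → semiregular d returns)
        (λ {j} 0<j j<d eq → minimal j<d (0<j , semiregular j eq)) i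

module MonoidUnits {a ℓ} (M : Monoid a ℓ) where
  open import Data.Nat.Base using (zero; suc)
  open import Data.Fin.Base using (Fin)
  open import Data.Fin.Permutation using (Permutation′; permutation)
  open import Data.Product using (Σ-syntax; _,_; proj₁; proj₂)
  open import Relation.Binary.PropositionalEquality using (_≡_; cong)
  open import Relation.Unary using (Pred)
  open PermutationPowers using (_^[_]_; Semiregular; semiregular⇒^[n]≡id)
  open Monoid M
  import Algebra.Definitions.RawMonoid rawMonoid as Mult
  open import Algebra.Properties.Monoid M using (cancelᶜ; cancelʳ; insertˡ)
  open import Relation.Binary.Reasoning.Setoid setoid

  infixr 8 _^_
  _^_ : Carrier → ℕ → Carrier
  x ^ n = n Mult.× x

  Unit : Pred Carrier (a ⊔ ℓ)
  Unit x = Σ[ y ∈ Carrier ] x ∙ y ≈ ε × y ∙ x ≈ ε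

  record IsSubgroupOfUnits {p} (P : Pred Carrier p) : Set (a ⊔ ℓ ⊔ p) where
    field
      ε∈       : P ε
      ∙-closed : ∀ {x y} → P x → P y → P (x ∙ y)
      inverse  : ∀ {x} → P x → Σ[ y ∈ Carrier ] P y × x ∙ y ≈ ε × y ∙ x ≈ ε

  units-isSubgroupOfUnits : IsSubgroupOfUnits Unit
  units-isSubgroupOfUnits = record
    { ε∈       = ε , identityˡ ε , identityˡ ε
    ; ∙-closed = λ { {x} {y} (x′ , xx′ , x′x) (y′ , yy′ , y′y) →
                     y′ ∙ x′ , trans (cancelᶜ yy′ x x′) xx′ , trans (cancelᶜ x′x y′ y) y′y }
    ; inverse  = λ { {x} (y , xy , yx) → y , (x , yx , xy) , xy , yx }
    }

  rightInverses⇒isSubgroupOfUnits : ∀ {p} {P : Pred Carrier p} → P ε →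
    (∀ {x y} → P x → P y → P (x ∙ y)) → (∀ {x} → P x → Σ[ y ∈ Carrier ] P y × x ∙ y ≈ ε) →
    IsSubgroupOfUnits P
  rightInverses⇒isSubgroupOfUnits {P = P} ε∈ ∙-closed rightInverse = record
    { ε∈ = ε∈ ; ∙-closed = ∙-closed ; inverse = inverse }
    where
    inverse : ∀ {x} → P x → Σ[ y ∈ Carrier ] P y × x ∙ y ≈ ε × y ∙ x ≈ ε
    inverse {x} x∈P with rightInverse x∈P
    ... | y , y∈P , xy with rightInverse y∈P
    ... | z , _ , yz = y , y∈P , xy , (begin
      y ∙ x             ≈⟨ identityʳ (y ∙ x) ⟨
      (y ∙ x) ∙ ε       ≈⟨ ∙-congˡ yz ⟨
      (y ∙ x) ∙ (y ∙ z) ≈⟨ cancelᶜ xy y z ⟩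
      y ∙ z             ≈⟨ yz ⟩
      ε                 ∎)

  HasCardinality : ∀ {p} → Pred Carrier p → ℕ → Set (a ⊔ ℓ ⊔ p)
  HasCardinality P n = Σ[ e ∈ (Fin n → Carrier) ]
      (∀ i → P (e i))
    × (∀ i j → e i ≈ e j → i ≡ j)
    × (∀ x → P x → Σ[ i ∈ Fin n ] x ≈ e i)

  lagrange : ∀ {p n} {P : Pred Carrier p} → IsSubgroupOfUnits P → HasCardinality P n →
             ∀ {g} → P g → g ^ n ≈ ε
  lagrange {n = n} {P} subgroup (e , e∈P , e-injective , e-surjective) {g} g∈P =
    fixed⇒≈ε n (semiregular⇒^[n]≡id ρ semiregular (index ε∈))
    where
    open IsSubgroupOfUnits subgroup

    index : ∀ {x} → P x → Fin n
    index {x} x∈P = proj₁ (e-surjective x x∈P)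

    shift : ∀ {x} → P x → Fin n → Fin n
    shift x∈P i = index (∙-closed (e∈P i) x∈P)

    e-shift : ∀ {x} (x∈P : P x) i → e (shift x∈P i) ≈ e i ∙ x
    e-shift x∈P i = sym (proj₂ (e-surjective _ (∙-closed (e∈P i) x∈P)))

    shift-inverse : ∀ {x y} (x∈P : P x) (y∈P : P y) → x ∙ y ≈ ε → ∀ i → shift y∈P (shift x∈P i) ≡ i
    shift-inverse {x} {y} x∈P y∈P xy i = e-injective _ _ (begin
      e (shift y∈P (shift x∈P i)) ≈⟨ e-shift y∈P _ ⟩
      e (shift x∈P i) ∙ y         ≈⟨ ∙-congʳ (e-shift x∈P i) ⟩
      (e i ∙ x) ∙ y               ≈⟨ cancelʳ xy (e i) ⟩
      e i                         ∎)

    ρ : Permutation′ n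
    ρ with inverse g∈P
    ... | h , h∈P , gh , hg =
      permutation (shift g∈P) (shift h∈P) (shift-inverse h∈P g∈P hg) (shift-inverse g∈P h∈P gh)

    e-^[] : ∀ j i → e (ρ ^[ j ] i) ≈ e i ∙ g ^ j
    e-^[] zero    i = sym (identityʳ (e i))
    e-^[] (suc j) i = begin
      e (ρ ^[ j ] (shift g∈P i)) ≈⟨ e-^[] j (shift g∈P i) ⟩
      e (shift g∈P i) ∙ g ^ j    ≈⟨ ∙-congʳ (e-shift g∈P i) ⟩
      (e i ∙ g) ∙ g ^ j          ≈⟨ assoc (e i) g (g ^ j) ⟩
      e i ∙ g ^ suc j            ∎

    fixed⇒≈ε : ∀ j {i} → ρ ^[ j ] i ≡ i → g ^ j ≈ ε
    fixed⇒≈ε j {i} fixed with inverse (e∈P i)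
    ... | u , _ , _ , ue = begin
      g ^ j               ≈⟨ insertˡ ue (g ^ j) ⟩
      u ∙ (e i ∙ g ^ j)   ≈⟨ ∙-congˡ (e-^[] j i) ⟨
      u ∙ e (ρ ^[ j ] i)  ≡⟨ cong (λ k → u ∙ e k) fixed ⟩
      u ∙ e i             ≈⟨ ue ⟩
      ε                   ∎

    semiregular : Semiregular ρ
    semiregular j {i} {i′} fixed = e-injective _ _ (begin
      e (ρ ^[ j ] i′)  ≈⟨ e-^[] j i′ ⟩
      e i′ ∙ g ^ j     ≈⟨ ∙-congˡ (fixed⇒≈ε j fixed) ⟩
      e i′ ∙ ε         ≈⟨ identityʳ (e i′) ⟩
      e i′             ∎)

module ModuloIdeal {c ℓ} (R : Ring c ℓ) where
  open import Data.Nat.Base as ℕ using (zero; suc)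
  import Data.Nat.Properties as ℕ
  open import Data.Fin.Base using (Fin; zero; suc)
  open import Data.Vec.Functional using (_∷_)
  open import Data.Product using (Σ-syntax; _,_; proj₁; proj₂)
  open import Relation.Binary.Core using (Rel; _⇒_)
  open import Relation.Binary.Structures using (IsEquivalence)
  open import Relation.Binary.PropositionalEquality as ≡ using (_≡_)
  open import Algebra.Definitions using (Congruent₂)
  open MonoidUnits
    using (IsSubgroupOfUnits; HasCardinality; units-isSubgroupOfUnits; rightInverses⇒isSubgroupOfUnits; lagrange)
  open Ring R renaming (_*_ to _·_; _+_ to _⊕_)
  open RingDefs R
  open import Relation.Binary.Reasoning.Setoid setoid

  module _ {ℓ′} {_∼_ : Rel Carrier ℓ′} (∼-isEquivalence : IsEquivalence _∼_)
           (≈⇒∼ : _≈_ ⇒ _∼_) (·-cong∼ : Congruent₂ _∼_ _·_) where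

    *-monoidModulo : Monoid c ℓ′
    *-monoidModulo = record
      { Carrier  = Carrier
      ; _≈_      = _∼_
      ; _∙_      = _·_
      ; ε        = 1#
      ; isMonoid = record
        { isSemigroup = record
          { isMagma = record { isEquivalence = ∼-isEquivalence ; ∙-cong = ·-cong∼ }
          ; assoc   = λ x y z → ≈⇒∼ (*-assoc x y z)
          }
        ; identity = (λ x → ≈⇒∼ (*-identityˡ x)) , (λ x → ≈⇒∼ (*-identityʳ x))
        }
      }

    pow≡^ : ∀ x n → pow x n ≡ MonoidUnits._^_ *-monoidModulo x n
    pow≡^ x zero    = ≡.refl
    pow≡^ x (suc n) = ≡.cong (x ·_) (pow≡^ x n)

  pow-+ : ∀ x m n → pow x (m ℕ.+ n) ≈ pow x m · pow x n
  pow-+ x zero    n = sym (*-identityˡ (pow x n))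
  pow-+ x (suc m) n = trans (*-congˡ (pow-+ x m n)) (sym (*-assoc x (pow x m) (pow x n)))

  pow-* : ∀ x m n → pow x (m ℕ.* n) ≈ pow (pow x m) n
  pow-* x m zero    = reflexive (≡.cong (pow x) (ℕ.*-zeroʳ m))
  pow-* x m (suc n) = begin
    pow x (m ℕ.* suc n)           ≡⟨ ≡.cong (pow x) (ℕ.*-suc m n) ⟩
    pow x (m ℕ.+ m ℕ.* n)         ≈⟨ pow-+ x m (m ℕ.* n) ⟩
    pow x m · pow x (m ℕ.* n)     ≈⟨ *-congˡ (pow-* x m n) ⟩
    pow x m · pow (pow x m) n     ∎

  pow-suc′ : ∀ x n → pow x (suc n) ≈ pow x n · x
  pow-suc′ x n = begin
    pow x (suc n)       ≡⟨ ≡.cong (pow x) (ℕ.+-comm 1 n) ⟩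
    pow x (n ℕ.+ 1)     ≈⟨ pow-+ x n 1 ⟩
    pow x n · (x · 1#)  ≈⟨ *-congˡ (*-identityʳ x) ⟩
    pow x n · x         ∎

  prodF-const : ∀ n x → prodF n (λ _ → x) ≈ pow x n
  prodF-const zero    x = refl
  prodF-const (suc n) x = *-congˡ (prodF-const n x)

  open import Algebra.Properties.AbelianGroup +-abelianGroup
    using (⁻¹-anti-homo‿-; ⁻¹-∙-comm; xyx⁻¹≈y)
  open import Algebra.Properties.Group +-group using (∙-cancelˡ; ε⁻¹≈ε; x∙y⁻¹≈ε⇒x≈y)
  open import Algebra.Properties.CommutativeSemigroup +-commutativeSemigroup using (interchange)
  open import Algebra.Properties.Monoid +-monoid using () renaming (cancelˡ to +-cancelˡ)
  open import Algebra.Properties.Ring R using ([y-z]x≈yx-zx; x[y-z]≈xy-xz)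

  [x-y]+[y-z]≈x-z : ∀ x y z → (x - y) ⊕ (y - z) ≈ x - z
  [x-y]+[y-z]≈x-z x y z = trans (+-assoc x (- y) (y - z)) (+-congˡ (+-cancelˡ (-‿inverseˡ y) (- z)))

  x+[y-x]≈y : ∀ x y → x ⊕ (y - x) ≈ y
  x+[y-x]≈y x y = trans (sym (+-assoc x y (- x))) (xyx⁻¹≈y x y)

  x-0≈x : ∀ x → x - 0# ≈ x
  x-0≈x x = trans (+-congˡ ε⁻¹≈ε) (+-identityʳ x)

  geometric : Carrier → ℕ → Carrier
  geometric x zero    = 0#
  geometric x (suc t) = 1# ⊕ geometric x t · x

  [1-x]·geometric≈1-pow : ∀ x t → (1# - x) · geometric x t ≈ 1# - pow x t
  [1-x]·geometric≈1-pow x zero    = trans (zeroʳ (1# - x)) (sym (-‿inverseʳ 1#))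
  [1-x]·geometric≈1-pow x (suc t) = begin
    (1# - x) · (1# ⊕ g · x)                 ≈⟨ distribˡ (1# - x) 1# (g · x) ⟩
    (1# - x) · 1# ⊕ (1# - x) · (g · x)      ≈⟨ +-cong (*-identityʳ (1# - x)) (sym (*-assoc (1# - x) g x)) ⟩
    (1# - x) ⊕ ((1# - x) · g) · x           ≈⟨ +-congˡ (*-congʳ ([1-x]·geometric≈1-pow x t)) ⟩
    (1# - x) ⊕ (1# - pow x t) · x           ≈⟨ +-congˡ ([y-z]x≈yx-zx x 1# (pow x t)) ⟩
    (1# - x) ⊕ (1# · x - pow x t · x)       ≈⟨ +-congˡ (+-cong (*-identityˡ x) (-‿cong (sym (pow-suc′ x t)))) ⟩
    (1# - x) ⊕ (x - pow x (suc t))          ≈⟨ [x-y]+[y-z]≈x-z 1# x (pow x (suc t)) ⟩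
    1# - pow x (suc t)                      ∎
    where
    g : Carrier
    g = geometric x t

  1-[1-x]≈x : ∀ x → 1# - (1# - x) ≈ x
  1-[1-x]≈x x = trans (+-congˡ (⁻¹-anti-homo‿- 1# x)) (x+[y-x]≈y 1# x)

  module _ {ℓN} {N : Carrier → Set ℓN} (ideal : IsIdeal N) where
    open IsIdeal ideal

    ≈⇒≡ : ∀ {x y} → x ≈ y → x ≡[ N ] y
    ≈⇒≡ {x} {y} x≈y = resp (sym (trans (+-congʳ x≈y) (-‿inverseʳ y))) zero∈

    ≡-refl : ∀ {x} → x ≡[ N ] x
    ≡-refl = ≈⇒≡ refl

    ≡-sym : ∀ {x y} → x ≡[ N ] y → y ≡[ N ] x
    ≡-sym {x} {y} x≡y = resp (⁻¹-anti-homo‿- x y) (neg-closed x≡y)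

    ≡-trans : ∀ {x y z} → x ≡[ N ] y → y ≡[ N ] z → x ≡[ N ] z
    ≡-trans {x} {y} {z} x≡y y≡z = resp ([x-y]+[y-z]≈x-z x y z) (+-closed x≡y y≡z)

    ≡-isEquivalence : IsEquivalence (λ x y → x ≡[ N ] y)
    ≡-isEquivalence = record { refl = ≡-refl ; sym = ≡-sym ; trans = ≡-trans }

    ≡-+ : ∀ {x x′ y y′} → x ≡[ N ] x′ → y ≡[ N ] y′ → (x ⊕ y) ≡[ N ] (x′ ⊕ y′)
    ≡-+ {x} {x′} {y} {y′} x≡x′ y≡y′ = resp
      (trans (interchange x (- x′) y (- y′)) (+-congˡ (⁻¹-∙-comm x′ y′))) (+-closed x≡x′ y≡y′)

    ≡-· : ∀ {x x′ y y′} → x ≡[ N ] x′ → y ≡[ N ] y′ → (x · y) ≡[ N ] (x′ · y′)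
    ≡-· {x} {x′} {y} {y′} x≡x′ y≡y′ = ≡-trans
      (resp ([y-z]x≈yx-zx y x x′) (absorbʳ y x≡x′))
      (resp (x[y-z]≈xy-xz x′ y y′) (absorbˡ x′ y≡y′))

    unit⇒unitMod : ∀ {x} → IsUnit x → IsUnitMod N x
    unit⇒unitMod (y , xy , yx) = y , ≈⇒≡ xy , ≈⇒≡ yx

    ∈⇒≡0 : ∀ {x} → N x → x ≡[ N ] 0#
    ∈⇒≡0 {x} x∈N = resp (sym (x-0≈x x)) x∈N

    ≡0⇒∈ : ∀ {x} → x ≡[ N ] 0# → N x
    ≡0⇒∈ {x} x≡0 = resp (x-0≈x x) x≡0

    geometric-≡ : ∀ {x} → 1# ≡[ N ] x → ∀ t → geometric x t ≡[ N ] nat· t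
    geometric-≡ 1≡x zero    = ≡-refl
    geometric-≡ 1≡x (suc t) =
      ≡-+ ≡-refl (≡-trans (≡-· (geometric-≡ 1≡x t) (≡-sym 1≡x)) (≈⇒≡ (*-identityʳ (nat· t))))

    Annihilates : ℕ → Carrier → Set (c ⊔ ℓ ⊔ ℓN)
    Annihilates r a = (f : Fin r → Carrier) → (∀ i → N (f i)) → a · prodF r f ≈ 0#

    annihilates-resp : ∀ {r a b} → a ≈ b → Annihilates r a → Annihilates r b
    annihilates-resp a≈b ann f f∈N = trans (*-congʳ (sym a≈b)) (ann f f∈N)

    annihilates-·∈ : ∀ {r a b} → Annihilates (suc r) a → N b → Annihilates r (a · b)
    annihilates-·∈ {a = a} {b} ann b∈N f f∈N = trans (*-assoc a b _) (ann (b ∷ f) λ where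
      zero    → b∈N
      (suc i) → f∈N i)

    ∈⇒annihilates : ∀ {r a} → PowZero N (suc r) → N a → Annihilates r a
    ∈⇒annihilates {a = a} nilpotent a∈N f f∈N = nilpotent (a ∷ f) λ where
      zero    → a∈N
      (suc i) → f∈N i

    annihilates-0⇒≈0 : ∀ {a} → Annihilates 0 a → a ≈ 0#
    annihilates-0⇒≈0 {a} ann = trans (sym (*-identityʳ a)) (ann (λ ()) (λ ()))

    UnipotentOfDepth : ℕ → Carrier → Set (c ⊔ ℓ ⊔ ℓN)
    UnipotentOfDepth r y = 1# ≡[ N ] y × Annihilates r (1# - y)

    unipotent-resp : ∀ {r x y} → x ≈ y → UnipotentOfDepth r x → UnipotentOfDepth r y
    unipotent-resp x≈y (1≡x , ann) =
      ≡-trans 1≡x (≈⇒≡ x≈y) , annihilates-resp (+-congˡ (-‿cong x≈y)) ann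

    module _ {s} (s∈N : N (nat· s)) where

      pow-s-lowers-depth : ∀ {r y} → UnipotentOfDepth (suc r) y → UnipotentOfDepth r (pow y s)
      pow-s-lowers-depth {y = y} (1≡y , ann) =
          resp telescope (absorbʳ g 1≡y)
        , annihilates-resp telescope (annihilates-·∈ ann g∈N)
        where
        g : Carrier
        g = geometric y s

        g∈N : N g
        g∈N = ≡0⇒∈ (≡-trans (geometric-≡ 1≡y s) (∈⇒≡0 s∈N))

        telescope : (1# - y) · g ≈ 1# - pow y s
        telescope = [1-x]·geometric≈1-pow y s

      pow-s^j-lowers-depth : ∀ j {r y} → UnipotentOfDepth (j ℕ.+ r) y → UnipotentOfDepth r (pow y (s ℕ.^ j))
      pow-s^j-lowers-depth zero    {y = y} unipotent = unipotent-resp (sym (*-identityʳ y)) unipotent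
      pow-s^j-lowers-depth (suc j) {y = y} unipotent = unipotent-resp (sym (pow-* y s (s ℕ.^ j)))
        (pow-s^j-lowers-depth j (pow-s-lowers-depth unipotent))

      pow-s^j≈1 : ∀ {j y} → PowZero N (suc j) → y ≡[ N ] 1# → pow y (s ℕ.^ j) ≈ 1#
      pow-s^j≈1 {j} {y} nilpotent y≡1 =
        sym (x∙y⁻¹≈ε⇒x≈y 1# _ (annihilates-0⇒≈0 (proj₂ (pow-s^j-lowers-depth j y-unipotent))))
        where
        y-unipotent : UnipotentOfDepth (j ℕ.+ 0) y
        y-unipotent = ≡-sym y≡1 , ≡.subst (λ r → Annihilates r (1# - y)) (≡.sym (ℕ.+-identityʳ j))
                                          (∈⇒annihilates nilpotent (≡-sym y≡1))

    *-monoid/N : Monoid c ℓN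
    *-monoid/N = *-monoidModulo ≡-isEquivalence ≈⇒≡ ≡-·

    pow-|units/N|≡1 : ∀ {m x} → HasCard (IsUnitMod N) (λ x y → x ≡[ N ] y) m →
                      IsUnitMod N x → pow x m ≡[ N ] 1#
    pow-|units/N|≡1 {m} {x} card x-unit =
      ≡.subst (λ z → z ≡[ N ] 1#) (≡.sym (pow≡^ ≡-isEquivalence ≈⇒≡ ≡-· x m))
        (lagrange *-monoid/N (units-isSubgroupOfUnits *-monoid/N) card x-unit)

    1+N-isSubgroupOfUnits : ∀ {k} → PowZero N k → IsSubgroupOfUnits *-monoid (λ z → z ≡[ N ] 1#)
    1+N-isSubgroupOfUnits {k} nilpotent = rightInverses⇒isSubgroupOfUnits *-monoid ≡-refl
      (λ x≡1 y≡1 → ≡-trans (≡-· x≡1 y≡1) (≈⇒≡ (*-identityˡ 1#))) rightInverse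
      where
      rightInverse : ∀ {z} → z ≡[ N ] 1# → Σ[ y ∈ Carrier ] y ≡[ N ] 1# × z · y ≈ 1#
      rightInverse {z} z≡1 = y , y≡1 , zy≈1
        where
        y : Carrier
        y = geometric (1# - z) k

        zy≈1 : z · y ≈ 1#
        zy≈1 = begin
          z · y                  ≈⟨ *-congʳ (1-[1-x]≈x z) ⟨
          (1# - (1# - z)) · y    ≈⟨ [1-x]·geometric≈1-pow (1# - z) k ⟩
          1# - pow (1# - z) k    ≈⟨ +-congˡ (-‿cong (trans (sym (prodF-const k (1# - z)))
                                                           (nilpotent _ (λ _ → ≡-sym z≡1)))) ⟩
          1# - 0#                ≈⟨ x-0≈x 1# ⟩
          1#                     ∎
        y≡1 : y ≡[ N ] 1#
        y≡1 = ≡-trans (≈⇒≡ (sym (*-identityˡ y)))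
                      (≡-trans (≡-· (≡-sym z≡1) ≡-refl) (≈⇒≡ zy≈1))

    1+N-hasCardinality : ∀ {n} → HasCard N _≈_ n → HasCardinality *-monoid (λ z → z ≡[ N ] 1#) n
    1+N-hasCardinality (e , e∈N , e-injective , e-surjective) =
        (λ i → 1# ⊕ e i)
      , (λ i → resp (sym (xyx⁻¹≈y 1# (e i))) (e∈N i))
      , (λ i j eq → e-injective i j (∙-cancelˡ 1# (e i) (e j) eq))
      , λ z z≡1 → proj₁ (e-surjective (z - 1#) z≡1)
                , trans (sym (x+[y-x]≈y 1# z)) (+-congˡ (proj₂ (e-surjective (z - 1#) z≡1)))

    pow-|N|≈1 : ∀ {k n y} → PowZero N k → HasCard N _≈_ n → y ≡[ N ] 1# → pow y n ≈ 1#
    -- *-monoid and *-monoidModulo _≈_ share their raw monoid, hence their powers.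
    pow-|N|≈1 {n = n} {y} nilpotent card y≡1 =
      ≡.subst (_≈ 1#) (≡.sym (pow≡^ isEquivalence (λ x≈y → x≈y) *-cong y n))
        (lagrange *-monoid (1+N-isSubgroupOfUnits nilpotent) (1+N-hasCardinality card) y≡1)

open import Data.Nat using (ℕ; _<_; _≤_; _*_; _^_; _∸_)
open Defs.RingDefs
open Ring using (Carrier; _≈_; 1#)
open import Data.Nat.Base using (suc; s≤s)
open import Data.Product using (_,_)

proposition4p1 : {c ℓ ℓN : Level} (R : Ring c ℓ) (N : Carrier R → Set ℓN)
    → (k s : ℕ) → IsIdeal R N → 2 ≤ k → NilpotencyIndex R N k → CharMod R N s → 1 < s
    → ((w : ℕ) → ((x : Carrier R) → IsUnitMod R N x → _≡[_]_ R (pow R x w) N (1# R))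
    → (x : Carrier R) → IsUnit R x → _≈_ R (pow R x (w * s ^ (k ∸ 1))) (1# R))
    × ((m : ℕ) → HasCard R (IsUnitMod R N) (λ x y → _≡[_]_ R x N y) m
    → (x : Carrier R) → IsUnit R x → _≈_ R (pow R x (m * s ^ (k ∸ 1))) (1# R))
    × ((u m n : ℕ) → HasCard R (IsUnit R) (_≈_ R) u
    → HasCard R (IsUnitMod R N) (λ x y → _≡[_]_ R x N y) m → HasCard R N (_≈_ R) n
    → (x : Carrier R) → IsUnit R x → _≈_ R (pow R x (m * n)) (1# R))
proposition4p1 R N (suc j) s ideal (s≤s _) (nilpotent , _) (_ , s∈N , _) _ =
    part1
  , (λ m card → part1 m (λ _ → pow-|units/N|≡1 ideal card))
  , λ _ m n _ card/N card x x-unit → trans (pow-* x m n)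
      (pow-|N|≈1 ideal nilpotent card (pow-|units/N|≡1 ideal card/N (unit⇒unitMod ideal x-unit)))
  where
  open Ring R using (trans)
  open ModuloIdeal R

  part1 : (w : ℕ) → ((x : Carrier R) → IsUnitMod R N x → _≡[_]_ R (pow R x w) N (1# R))
        → (x : Carrier R) → IsUnit R x → _≈_ R (pow R x (w * s ^ j)) (1# R)
  part1 w hyp x x-unit = trans (pow-* x w (s ^ j))
    (pow-s^j≈1 ideal s∈N nilpotent (hyp x (unit⇒unitMod ideal x-unit)))
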